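{- Let $n \geq 0$ and $m \geq 1$ be integers, let $F_j$ denote the $j$th Fibonacci number ($F_0=0$, $F_1=1$), and let $0 \leq k_1, \ldots, k_m, k'_1, \ldots, k'_m \leq n$. Then \[ \sum_{i=1}^m F_{k_i}F_{2n-k_i} \equiv \sum_{i=1}^m F_{k'_i}F_{2n-k'_i} \pmod{F_{2n}} \iff \sum_{i=1}^m F_{n-k_i}F_{n+k_i} \equiv \sum_{i=1}^m F_{n-k'_i}F_{n+k'_i} \pmod{F_{2n}}. \] -}

module Defs where

open import Data.Nat using (ℕ; zero; suc; _+_; _*_; _∸_)
open import Data.Fin using (Fin)
open import Data.Integer using (ℤ; +_; _-_)
open import Data.Integer.Divisibility using (_∣_)

F : ℕ → ℕ
F zero = 0
F (suc zero) = 1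
F (suc (suc j)) = F (suc j) + F j

Σ : (m : ℕ) → (Fin m → ℕ) → ℕ
Σ zero f = 0
Σ (suc m) f = f Fin.zero + Σ m (λ i → f (Fin.suc i))

-- congruence modulo d (d may be 0, then it is equality): d divides a - b in ℤ
_≡_[mod_] : ℕ → ℕ → ℕ → Set
a ≡ b [mod d ] = (+ d) ∣ ((+ a) - (+ b))

{-# OPTIONS --safe #-}
module Submission where

-- d'Ocagne's identity gives F(2n−k) ≡ (−1)^(k+1) F(2n+1) F(k) (mod F(2n)), and Catalan's identity
-- F(k)² = (−1)^(n−k) (F(n)² − F(n−k) F(n+k)) turns F(k) F(2n−k) ≡ (−1)^(k+1) F(2n+1) F(k)² into
-- F(k) F(2n−k) ≡ c (F(n−k) F(n+k) − F(n)²) with c = (−1)^n F(2n+1) independent of k.  Summing,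
-- the difference of the two sides of the first congruence is c times that of the second modulo F(2n),
-- and c is invertible modulo F(2n) because consecutive Fibonacci numbers are coprime.

open import Defs
open import Data.Fin using (Fin)
open import Function using (_∘_)
open import Function.Bundles using (_⇔_; mk⇔; Equivalence)
open import Relation.Binary.PropositionalEquality
  using (_≡_; sym; trans; cong; cong₂; subst; module ≡-Reasoning)

module FibonacciCongruences where

  open import Data.Nat as ℕ using (ℕ; zero; suc)
  open import Data.Nat.Properties using (+-comm; m+[n∸m]≡n; m∸n+n≡m; m≤n⇒m≤o*n)
  import Data.Nat.Coprimality as ℕ using (Coprime)
  import Data.Nat.Divisibility as ℕ using (∣1⇒≡1; ∣m+n∣m⇒∣n)
  open import Data.Fin using (zero; suc)
  open import Data.Integer using (ℤ; +_; 0ℤ; 1ℤ; -1ℤ; -_; ∣_∣; _^_; _+_; _-_; _*_)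
  open import Data.Integer.Properties
    using (pos-*; *-assoc; *-identityˡ; *-distribʳ-+; ∣-i∣≡∣i∣; -1*i≡-i; ^-distribˡ-+-*)
  open import Data.Integer.Coprimality using (Coprime; coprime-divisor)
  open import Data.Integer.Divisibility.Signed
    using (_∣_; divides; ∣ᵤ⇒∣; ∣⇒∣ᵤ; ∣m∣n⇒∣m+n; ∣m∣n⇒∣m-n; ∣m+n∣m⇒∣n; ∣n⇒∣m*n)
  open import Data.Integer.Tactic.RingSolver using (solve-∀; solve)
  open import Data.List using ([]; _∷_)
  open import Data.Product using (_,_)
  open ≡-Reasoning

  Fℤ : ℕ → ℤ
  Fℤ n = + F n

  d'Ocagne : ∀ j i → Fℤ i ≡ -1ℤ ^ j * (Fℤ (suc j) * Fℤ (j ℕ.+ i) - Fℤ j * Fℤ (suc (j ℕ.+ i)))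
  d'Ocagne zero i = base (Fℤ i) (Fℤ (suc i))
    where
    base : ∀ x y → x ≡ 1ℤ * (1ℤ * x - 0ℤ * y)
    base = solve-∀
  d'Ocagne (suc j) i =
    trans (d'Ocagne j i) (step (-1ℤ ^ j) (Fℤ (suc j)) (Fℤ j) (Fℤ (suc (j ℕ.+ i))) (Fℤ (j ℕ.+ i)))
    where
    step : ∀ s p₁ p₀ q₁ q₀ → s * (p₁ * q₀ - p₀ * q₁) ≡ -1ℤ * s * ((p₁ + p₀) * q₁ - p₁ * (q₁ + q₀))
    step = solve-∀

  vajda : ∀ j a b →
    Fℤ a * Fℤ b ≡ -1ℤ ^ j * (Fℤ (a ℕ.+ j) * Fℤ (j ℕ.+ b) - Fℤ j * Fℤ (a ℕ.+ (j ℕ.+ b)))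
  vajda j zero b = vanish (-1ℤ ^ j) (Fℤ j) (Fℤ (j ℕ.+ b)) (Fℤ b)
    where
    vanish : ∀ s x y z → 0ℤ * z ≡ s * (x * y - x * y)
    vanish = solve-∀
  vajda j (suc zero) b = trans (*-identityˡ (Fℤ b)) (d'Ocagne j b)
  vajda j (suc (suc a)) b = begin
    (Fℤ (suc a) + Fℤ a) * Fℤ b                    ≡⟨ *-distribʳ-+ (Fℤ b) (Fℤ (suc a)) (Fℤ a) ⟩
    Fℤ (suc a) * Fℤ b + Fℤ a * Fℤ b               ≡⟨ cong₂ _+_ (vajda j (suc a) b) (vajda j a b) ⟩
    s * (p₁ * y - x * q₁) + s * (p₀ * y - x * q₀) ≡⟨ step s p₁ p₀ y x q₁ q₀ ⟩
    s * ((p₁ + p₀) * y - x * (q₁ + q₀))           ∎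
    where
    s = -1ℤ ^ j
    p₁ = Fℤ (suc (a ℕ.+ j)); p₀ = Fℤ (a ℕ.+ j); y = Fℤ (j ℕ.+ b); x = Fℤ j
    q₁ = Fℤ (suc (a ℕ.+ (j ℕ.+ b))); q₀ = Fℤ (a ℕ.+ (j ℕ.+ b))
    step : ∀ s p₁ p₀ y x q₁ q₀ →
      s * (p₁ * y - x * q₁) + s * (p₀ * y - x * q₀) ≡ s * ((p₁ + p₀) * y - x * (q₁ + q₀))
    step = solve-∀

  catalan : ∀ {n k} → k ℕ.≤ n →
    Fℤ k * Fℤ k ≡ -1ℤ ^ (n ℕ.∸ k) * (Fℤ n * Fℤ n - Fℤ (n ℕ.∸ k) * Fℤ (n ℕ.+ k))
  catalan {n} {k} k≤n = begin
    Fℤ k * Fℤ k                                 ≡⟨ vajda j k k ⟩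
    t * (Fℤ (k ℕ.+ j) * Fℤ (j ℕ.+ k) - Fℤ j * Fℤ (k ℕ.+ (j ℕ.+ k)))
      ≡⟨ cong₂ (λ p q → t * (Fℤ p * Fℤ q - Fℤ j * Fℤ (k ℕ.+ q))) (m+[n∸m]≡n k≤n) (m∸n+n≡m k≤n) ⟩
    t * (Fℤ n * Fℤ n - Fℤ j * Fℤ (k ℕ.+ n))
      ≡⟨ cong (λ p → t * (Fℤ n * Fℤ n - Fℤ j * Fℤ p)) (+-comm k n) ⟩
    t * (Fℤ n * Fℤ n - Fℤ j * Fℤ (n ℕ.+ k))     ∎
    where
    j = n ℕ.∸ k
    t = -1ℤ ^ j

  F-d'Ocagne-congruence : ∀ {N k} → k ℕ.≤ N →
    Fℤ N ∣ Fℤ k * Fℤ (N ℕ.∸ k) + -1ℤ ^ k * Fℤ (suc N) * (Fℤ k * Fℤ k)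
  F-d'Ocagne-congruence {N} {k} k≤N = divides (s * K * P) (begin
    K * Fℤ (N ℕ.∸ k) + s * A * (K * K)          ≡⟨ cong (λ x → K * x + s * A * (K * K)) d'Ocagne-at-N ⟩
    K * (s * (P * D - K * A)) + s * A * (K * K) ≡⟨ cancel s K P D A ⟩
    s * K * P * D                               ∎)
    where
    s = -1ℤ ^ k; K = Fℤ k; P = Fℤ (suc k); D = Fℤ N; A = Fℤ (suc N)
    d'Ocagne-at-N : Fℤ (N ℕ.∸ k) ≡ s * (P * D - K * A)
    d'Ocagne-at-N = subst (λ p → Fℤ (N ℕ.∸ k) ≡ s * (P * Fℤ p - K * Fℤ (suc p)))
                          (m+[n∸m]≡n k≤N) (d'Ocagne k (N ℕ.∸ k))
    cancel : ∀ s K P D A → K * (s * (P * D - K * A)) + s * A * (K * K) ≡ s * K * P * D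
    cancel = solve-∀

  left-summand right-summand : ℕ → ℕ → ℕ
  left-summand n k = F k ℕ.* F (2 ℕ.* n ℕ.∸ k)
  right-summand n k = F (n ℕ.∸ k) ℕ.* F (n ℕ.+ k)

  multiplier : ℕ → ℤ
  multiplier n = -1ℤ ^ n * Fℤ (suc (2 ℕ.* n))

  F-term-congruence : ∀ {n k} → k ℕ.≤ n →
    Fℤ (2 ℕ.* n) ∣ + left-summand n k + multiplier n * (Fℤ n * Fℤ n - + right-summand n k)
  F-term-congruence {n} {k} k≤n =
    subst (Fℤ (2 ℕ.* n) ∣_) (cong₂ _+_ (sym (pos-* (F k) (F (2 ℕ.* n ℕ.∸ k)))) catalan-term)
          (F-d'Ocagne-congruence (m≤n⇒m≤o*n 2 k≤n))
    where
    s = -1ℤ ^ k; t = -1ℤ ^ (n ℕ.∸ k); A = Fℤ (suc (2 ℕ.* n))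
    E = Fℤ n * Fℤ n - Fℤ (n ℕ.∸ k) * Fℤ (n ℕ.+ k)
    regroup : ∀ s A t E → s * A * (t * E) ≡ t * s * A * E
    regroup = solve-∀
    catalan-term : s * A * (Fℤ k * Fℤ k) ≡ multiplier n * (Fℤ n * Fℤ n - + right-summand n k)
    catalan-term = begin
      s * A * (Fℤ k * Fℤ k)         ≡⟨ cong (s * A *_) (catalan k≤n) ⟩
      s * A * (t * E)               ≡⟨ regroup s A t E ⟩
      t * s * A * E                 ≡⟨ cong (λ u → u * A * E) (^-distribˡ-+-* -1ℤ (n ℕ.∸ k) k) ⟨
      -1ℤ ^ (n ℕ.∸ k ℕ.+ k) * A * E ≡⟨ cong (λ p → -1ℤ ^ p * A * E) (m∸n+n≡m k≤n) ⟩
      multiplier n * E              ≡⟨ cong (λ z → multiplier n * (Fℤ n * Fℤ n - z))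
                                            (pos-* (F (n ℕ.∸ k)) (F (n ℕ.+ k))) ⟨
      multiplier n * (Fℤ n * Fℤ n - + right-summand n k) ∎

  F-pair-congruence : ∀ {n k k′} → k ℕ.≤ n → k′ ℕ.≤ n →
    Fℤ (2 ℕ.* n) ∣ (+ left-summand n k - + left-summand n k′)
                   - multiplier n * (+ right-summand n k - + right-summand n k′)
  F-pair-congruence {n} {k} {k′} k≤n k′≤n =
    subst (Fℤ (2 ℕ.* n) ∣_)
          (cancel-constant (+ left-summand n k) (+ left-summand n k′) (+ right-summand n k) (+ right-summand n k′)
                           (multiplier n) (Fℤ n * Fℤ n))
          (∣m∣n⇒∣m-n (F-term-congruence k≤n) (F-term-congruence k′≤n))
    where
    cancel-constant : ∀ a a′ b b′ c e → (a + c * (e - b)) - (a′ + c * (e - b′)) ≡ (a - a′) - c * (b - b′)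
    cancel-constant = solve-∀

  ∣-Σ-combination : ∀ {d} c m (f f′ g g′ : Fin m → ℕ) →
    (∀ i → d ∣ (+ f i - + f′ i) - c * (+ g i - + g′ i)) →
    d ∣ (+ Σ m f - + Σ m f′) - c * (+ Σ m g - + Σ m g′)
  ∣-Σ-combination {d} c zero f f′ g g′ _ = divides 0ℤ (solve (c ∷ d ∷ []))
  ∣-Σ-combination {d} c (suc m) f f′ g g′ d∣ =
    subst (d ∣_) (sym (regroup (head f) (tail f) (head f′) (tail f′) (head g) (tail g) (head g′) (tail g′) c))
          (∣m∣n⇒∣m+n (d∣ zero) (∣-Σ-combination c m (f ∘ suc) (f′ ∘ suc) (g ∘ suc) (g′ ∘ suc) (d∣ ∘ suc)))
    where
    head tail : (Fin (suc m) → ℕ) → ℤ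
    head h = + h zero
    tail h = + Σ m (h ∘ suc)
    regroup : ∀ a A a′ A′ b B b′ B′ c →
      ((a + A) - (a′ + A′)) - c * ((b + B) - (b′ + B′)) ≡ ((a - a′) - c * (b - b′)) + ((A - A′) - c * (B - B′))
    regroup = solve-∀

  ∣-1^n*i∣≡∣i∣ : ∀ n i → ∣ -1ℤ ^ n * i ∣ ≡ ∣ i ∣
  ∣-1^n*i∣≡∣i∣ zero i = cong ∣_∣ (*-identityˡ i)
  ∣-1^n*i∣≡∣i∣ (suc n) i = begin
    ∣ -1ℤ * -1ℤ ^ n * i ∣     ≡⟨ cong ∣_∣ (*-assoc -1ℤ (-1ℤ ^ n) i) ⟩
    ∣ -1ℤ * (-1ℤ ^ n * i) ∣   ≡⟨ cong ∣_∣ (-1*i≡-i (-1ℤ ^ n * i)) ⟩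
    ∣ - (-1ℤ ^ n * i) ∣       ≡⟨ ∣-i∣≡∣i∣ (-1ℤ ^ n * i) ⟩
    ∣ -1ℤ ^ n * i ∣           ≡⟨ ∣-1^n*i∣≡∣i∣ n i ⟩
    ∣ i ∣                     ∎

  F-coprime : ∀ n → ℕ.Coprime (F n) (F (suc n))
  F-coprime zero (_ , d∣1) = ℕ.∣1⇒≡1 d∣1
  F-coprime (suc n) (d∣F[1+n] , d∣F[2+n]) = F-coprime n (ℕ.∣m+n∣m⇒∣n d∣F[2+n] d∣F[1+n] , d∣F[1+n])

  multiplier-coprime : ∀ n → Coprime (Fℤ (2 ℕ.* n)) (multiplier n)
  multiplier-coprime n =
    subst (ℕ.Coprime (F (2 ℕ.* n))) (sym (∣-1^n*i∣≡∣i∣ n (Fℤ (suc (2 ℕ.* n))))) (F-coprime (2 ℕ.* n))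

  coprime∧∣m-c*n⇒∣m⇔∣n : ∀ {d} c {x y} → Coprime d c → d ∣ x - c * y → (d ∣ x) ⇔ (d ∣ y)
  coprime∧∣m-c*n⇒∣m⇔∣n {d} c {x} {y} d⊥c d∣x-cy = mk⇔ to from
    where
    x≡[x-cy]+cy : x ≡ (x - c * y) + c * y
    x≡[x-cy]+cy = solve (x ∷ c ∷ y ∷ [])
    to : d ∣ x → d ∣ y
    to d∣x = ∣ᵤ⇒∣ (coprime-divisor d c y d⊥c (∣⇒∣ᵤ (∣m+n∣m⇒∣n (subst (d ∣_) x≡[x-cy]+cy d∣x) d∣x-cy)))
    from : d ∣ y → d ∣ x
    from d∣y = subst (d ∣_) (sym x≡[x-cy]+cy) (∣m∣n⇒∣m+n d∣x-cy (∣n⇒∣m*n c d∣y))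

open FibonacciCongruences
  using ( left-summand; right-summand; multiplier; multiplier-coprime
        ; F-pair-congruence; ∣-Σ-combination; coprime∧∣m-c*n⇒∣m⇔∣n )
open import Data.Nat using (ℕ; _+_; _*_; _∸_; _≤_; _≥_)
open import Data.Integer using (+_; _-_)
open import Data.Integer.Divisibility.Signed using (_∣_; ∣ᵤ⇒∣; ∣⇒∣ᵤ)

theorem1p4 : (n m : ℕ) → m ≥ 1 → (k k′ : Fin m → ℕ) →
    (∀ i → k i ≤ n) → (∀ i → k′ i ≤ n) →
    ((Σ m (λ i → F (k i) * F (2 * n ∸ k i)) ≡ Σ m (λ i → F (k′ i) * F (2 * n ∸ k′ i)) [mod F (2 * n) ])
      ⇔ (Σ m (λ i → F (n ∸ k i) * F (n + k i)) ≡ Σ m (λ i → F (n ∸ k′ i) * F (n + k′ i)) [mod F (2 * n) ]))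
theorem1p4 n m _ k k′ k≤n k′≤n = mk⇔ (∣⇒∣ᵤ ∘ to ∘ ∣ᵤ⇒∣) (∣⇒∣ᵤ ∘ from ∘ ∣ᵤ⇒∣)
  where
  left = left-summand n
  right = right-summand n
  sums⇔ : (+ F (2 * n) ∣ + Σ m (left ∘ k) - + Σ m (left ∘ k′))
        ⇔ (+ F (2 * n) ∣ + Σ m (right ∘ k) - + Σ m (right ∘ k′))
  sums⇔ = coprime∧∣m-c*n⇒∣m⇔∣n (multiplier n) (multiplier-coprime n)
    (∣-Σ-combination (multiplier n) m (left ∘ k) (left ∘ k′) (right ∘ k) (right ∘ k′)
      (λ i → F-pair-congruence (k≤n i) (k′≤n i)))
  open Equivalence sums⇔
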